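{- For every positive integer $n$, $a_{n,n} = 2F_n$.
   Context: $\mathbb{N}=\{1,2,3,\dots\}$, and $\mathcal{N}$ denotes the collection of finite subsets of $\mathbb{N}$. For $E\in\mathcal{N}$ and $k\in\mathbb{N}$, let $\omega_k(E)=\sum_{i\in E,\, i\neq k}1$, i.e. the number of elements of $E$ different from $k$. For $k,n\in\mathbb{N}$, let $\mathcal{A}_{k,n}=\{E\in\mathcal{N} : E=\emptyset \text{ or } \omega_k(E)<\min E\le \max E\le n\}$ and $a_{k,n}=|\mathcal{A}_{k,n}|$. $(F_n)_{n\ge0}$ is the Fibonacci sequence: $F_0=0$, $F_1=1$, $F_n=F_{n-1}+F_{n-2}$ for $n\ge2$. -}

module Defs where

open import Data.Nat using (ℕ; zero; suc; _+_; _*_; _<_; _≡ᵇ_; _<?_)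
open import Data.Bool using (Bool; true; false; if_then_else_)
open import Data.Vec using (Vec; []; _∷_; replicate)
open import Data.List using (List; []; _∷_; [_]; map; _++_; length; filter)
open import Data.Sum using (_⊎_)
open import Relation.Binary.PropositionalEquality using (_≡_)
open import Relation.Nullary using (Dec)
open import Relation.Nullary.Decidable using (_⊎-dec_)
import Data.Vec.Properties as VecP
import Data.Bool.Properties as BoolP

-- A finite set E ⊆ {1,…,n} is encoded as a vector v : Vec Bool n,
-- where position i (0-based) is true iff the number i+1 belongs to E.
-- Every E ∈ 𝒜_{k,n} satisfies E ⊆ {1,…,n} (elements of ℕ are ≥ 1, and
-- max E ≤ n), so 𝒜_{k,n} is a subfamily of these sets.
SubsetUpTo : ℕ → Set
SubsetUpTo n = Vec Bool n

∅ : ∀ {n} → SubsetUpTo n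
∅ {n} = replicate n false

allSubsets : (n : ℕ) → List (SubsetUpTo n)
allSubsets zero = [ [] ]
allSubsets (suc n) = map (true ∷_) (allSubsets n) ++ map (false ∷_) (allSubsets n)

ωFrom : ℕ → ℕ → ∀ {n} → Vec Bool n → ℕ
ωFrom k m [] = 0
ωFrom k m (true ∷ v) = (if m ≡ᵇ k then 0 else 1) + ωFrom k (suc m) v
ωFrom k m (false ∷ v) = ωFrom k (suc m) v

-- ω_k(E) = #{ i ∈ E : i ≠ k }
ω : ℕ → ∀ {n} → SubsetUpTo n → ℕ
ω k E = ωFrom k 1 E

-- least element (value 0 for the empty set; only used for nonempty sets)
minFrom : ℕ → ∀ {n} → Vec Bool n → ℕ
minFrom m [] = 0
minFrom m (true ∷ v) = m
minFrom m (false ∷ v) = minFrom (suc m) v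

minE : ∀ {n} → SubsetUpTo n → ℕ
minE E = minFrom 1 E

-- membership in 𝒜_{k,n}:  E = ∅  or  ω_k(E) < min E  (max E ≤ n is built in)
In𝒜 : (k : ℕ) → ∀ {n} → SubsetUpTo n → Set
In𝒜 k E = (E ≡ ∅) ⊎ (ω k E < minE E)

in𝒜? : (k : ℕ) → ∀ {n} → (E : SubsetUpTo n) → Dec (In𝒜 k E)
in𝒜? k E = VecP.≡-dec BoolP._≟_ E ∅ ⊎-dec (ω k E <? minE E)

a : ℕ → ℕ → ℕ
a k n = length (filter (in𝒜? k) (allSubsets n))

F : ℕ → ℕ
F zero = 0
F (suc zero) = 1
F (suc (suc n)) = F (suc n) + F n

-- Split E ∈ 𝒜_{n,n} according to whether n ∈ E.  Since n is the largest
-- possible element, ω_n(E) = |E ∖ {n}|, and removing n from E keeps min E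
-- unless E = {n}; so either way E ∖ {n} ranges over the sets W ⊆ {1,…,n-1}
-- with W = ∅ or |W| < min W, and a_{n,n} is twice their number.  Those sets
-- are counted by F_n: split on whether the maximum m+2 lies in W; if it
-- does then 1 ∉ W, and shifting W ∖ {m+2} down by one gives a set of the
-- same kind in {1,…,m}.
module Submission where

open import Defs
open import Data.Nat using (ℕ; zero; suc; _+_; _*_; _≤_; _<ᵇ_; _≡ᵇ_)
open import Data.Nat.Properties using (+-comm; +-suc; +-identityʳ; +-commutativeSemigroup)
open import Algebra.Properties.CommutativeSemigroup +-commutativeSemigroup using (interchange)
open import Data.Bool using (Bool; true; false; _∨_; _∧_; not; if_then_else_)
open import Data.Vec using (Vec; []; _∷_; _∷ʳ_)
open import Data.List using (List; []; _∷_; _++_; map; length; filter)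
open import Data.List.Properties using (filter-++; length-++)
open import Data.Vec.Properties using (≡-dec)
open import Data.Bool.Properties using (_≟_)
open import Relation.Nullary using (does)
open import Relation.Unary using (Pred; Decidable)
open import Relation.Binary.PropositionalEquality using (_≡_; refl; sym; cong; cong₂)
open Relation.Binary.PropositionalEquality.≡-Reasoning

count : ∀ n → (Vec Bool n → Bool) → ℕ
count zero    p = if p [] then 1 else 0
count (suc n) p = count n (λ v → p (true ∷ v)) + count n (λ v → p (false ∷ v))

length-filter-map : ∀ {A B : Set} {ℓ} {P : Pred B ℓ} (P? : Decidable P) (f : A → B) xs →
                    length (filter P? (map f xs)) ≡ length (filter (λ x → P? (f x)) xs)
length-filter-map P? f []       = refl
length-filter-map P? f (x ∷ xs) with does (P? (f x))
... | true  = cong suc (length-filter-map P? f xs)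
... | false = length-filter-map P? f xs

length-filter-allSubsets : ∀ n {ℓ} {P : Pred (Vec Bool n) ℓ} (P? : Decidable P) →
                           length (filter P? (allSubsets n)) ≡ count n (λ v → does (P? v))
length-filter-allSubsets zero    P? with does (P? [])
... | true  = refl
... | false = refl
length-filter-allSubsets (suc n) P? = begin
  length (filter P? (map (true ∷_) subsets ++ map (false ∷_) subsets))
    ≡⟨ cong length (filter-++ P? (map (true ∷_) subsets) _) ⟩
  length (filter P? (map (true ∷_) subsets) ++ filter P? (map (false ∷_) subsets))
    ≡⟨ length-++ (filter P? (map (true ∷_) subsets)) ⟩
  length (filter P? (map (true ∷_) subsets)) + length (filter P? (map (false ∷_) subsets))
    ≡⟨ cong₂ _+_ (length-filter-map P? (true ∷_) subsets) (length-filter-map P? (false ∷_) subsets) ⟩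
  length (filter (λ v → P? (true ∷ v)) subsets) + length (filter (λ v → P? (false ∷ v)) subsets)
    ≡⟨ cong₂ _+_ (length-filter-allSubsets n _) (length-filter-allSubsets n _) ⟩
  count (suc n) (λ v → does (P? v)) ∎
  where
  subsets : List (Vec Bool n)
  subsets = allSubsets n

count-cong : ∀ n {p q : Vec Bool n → Bool} → (∀ v → p v ≡ q v) → count n p ≡ count n q
count-cong zero    p≗q = cong (λ b → if b then 1 else 0) (p≗q [])
count-cong (suc n) p≗q =
  cong₂ _+_ (count-cong n (λ v → p≗q (true ∷ v))) (count-cong n (λ v → p≗q (false ∷ v)))

count-false : ∀ n → count n (λ _ → false) ≡ 0
count-false zero    = refl
count-false (suc n) = cong₂ _+_ (count-false n) (count-false n)

count-∷ʳ : ∀ n (p : Vec Bool (suc n) → Bool) →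
           count (suc n) p ≡ count n (λ w → p (w ∷ʳ true)) + count n (λ w → p (w ∷ʳ false))
count-∷ʳ zero    p = refl
count-∷ʳ (suc n) p = begin
  count (suc n) (λ v → p (true ∷ v)) + count (suc n) (λ v → p (false ∷ v))
    ≡⟨ cong₂ _+_ (count-∷ʳ n (λ v → p (true ∷ v))) (count-∷ʳ n (λ v → p (false ∷ v))) ⟩
  (true-true + true-false) + (false-true + false-false)
    ≡⟨ interchange true-true true-false false-true false-false ⟩
  count (suc n) (λ w → p (w ∷ʳ true)) + count (suc n) (λ w → p (w ∷ʳ false)) ∎
  where
  true-true true-false false-true false-false : ℕ
  true-true   = count n (λ w → p (true  ∷ (w ∷ʳ true)))
  true-false  = count n (λ w → p (true  ∷ (w ∷ʳ false)))
  false-true  = count n (λ w → p (false ∷ (w ∷ʳ true)))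
  false-false = count n (λ w → p (false ∷ (w ∷ʳ false)))

isEmptyᵇ : ∀ {n} → Vec Bool n → Bool
isEmptyᵇ []          = true
isEmptyᵇ (true  ∷ v) = false
isEmptyᵇ (false ∷ v) = isEmptyᵇ v

size : ∀ {n} → Vec Bool n → ℕ
size []          = 0
size (true  ∷ v) = suc (size v)
size (false ∷ v) = size v

does-≟-∅ : ∀ {n} (v : Vec Bool n) → does (≡-dec _≟_ v ∅) ≡ isEmptyᵇ v
does-≟-∅ []          = refl
does-≟-∅ (true  ∷ v) = refl
does-≟-∅ (false ∷ v) = does-≟-∅ v

isEmptyᵇ⇒size≡0 : ∀ {n} (v : Vec Bool n) → isEmptyᵇ v ≡ true → size v ≡ 0
isEmptyᵇ⇒size≡0 []          _     = refl
isEmptyᵇ⇒size≡0 (false ∷ v) empty = isEmptyᵇ⇒size≡0 v empty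

isEmptyᵇ-∷ʳ : ∀ {n} (w : Vec Bool n) b → isEmptyᵇ (w ∷ʳ b) ≡ isEmptyᵇ w ∧ not b
isEmptyᵇ-∷ʳ []          true  = refl
isEmptyᵇ-∷ʳ []          false = refl
isEmptyᵇ-∷ʳ (true  ∷ w) b     = refl
isEmptyᵇ-∷ʳ (false ∷ w) b     = isEmptyᵇ-∷ʳ w b

size-∷ʳ-true : ∀ {n} (w : Vec Bool n) → size (w ∷ʳ true) ≡ suc (size w)
size-∷ʳ-true []          = refl
size-∷ʳ-true (true  ∷ w) = cong suc (size-∷ʳ-true w)
size-∷ʳ-true (false ∷ w) = size-∷ʳ-true w

size-∷ʳ-false : ∀ {n} (w : Vec Bool n) → size (w ∷ʳ false) ≡ size w
size-∷ʳ-false []          = refl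
size-∷ʳ-false (true  ∷ w) = cong suc (size-∷ʳ-false w)
size-∷ʳ-false (false ∷ w) = size-∷ʳ-false w

minFrom-∷ʳ : ∀ {n} s (w : Vec Bool n) b → isEmptyᵇ w ≡ false → minFrom s (w ∷ʳ b) ≡ minFrom s w
minFrom-∷ʳ s (true  ∷ w) b nonempty = refl
minFrom-∷ʳ s (false ∷ w) b nonempty = minFrom-∷ʳ (suc s) w b nonempty

minFrom-∅-∷ʳ-true : ∀ {n} s (w : Vec Bool n) → isEmptyᵇ w ≡ true → minFrom s (w ∷ʳ true) ≡ s + n
minFrom-∅-∷ʳ-true         s []          _     = sym (+-identityʳ s)
minFrom-∅-∷ʳ-true {suc n} s (false ∷ w) empty = begin
  minFrom (suc s) (w ∷ʳ true) ≡⟨ minFrom-∅-∷ʳ-true (suc s) w empty ⟩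
  suc s + n                   ≡⟨ sym (+-suc s n) ⟩
  s + suc n                   ∎

minFrom-suc : ∀ {n} s (w : Vec Bool n) → isEmptyᵇ w ≡ false → minFrom (suc s) w ≡ suc (minFrom s w)
minFrom-suc s (true  ∷ w) nonempty = refl
minFrom-suc s (false ∷ w) nonempty = minFrom-suc (suc s) w nonempty

≡ᵇ-refl : ∀ m → (m ≡ᵇ m) ≡ true
≡ᵇ-refl zero    = refl
≡ᵇ-refl (suc m) = ≡ᵇ-refl m

≡ᵇ-+-suc : ∀ m n → (m ≡ᵇ m + suc n) ≡ false
≡ᵇ-+-suc zero    n = refl
≡ᵇ-+-suc (suc m) n = ≡ᵇ-+-suc m n

-- With positions numbered from s, the last bit of w ∷ʳ b stands for s + n.
ωFrom-last : ∀ {n} s (w : Vec Bool n) b → ωFrom (s + n) s (w ∷ʳ b) ≡ size w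
ωFrom-last         s []          true  rewrite +-identityʳ s | ≡ᵇ-refl s = refl
ωFrom-last         s []          false = refl
ωFrom-last {suc n} s (true  ∷ w) b     rewrite ≡ᵇ-+-suc s n | +-suc s n = cong suc (ωFrom-last (suc s) w b)
ωFrom-last {suc n} s (false ∷ w) b     rewrite +-suc s n = ωFrom-last (suc s) w b

schreierᵇ : ∀ {n} → Vec Bool n → Bool
schreierᵇ v = isEmptyᵇ v ∨ (size v <ᵇ minE v)

schreierᵇ-∷ʳ-false : ∀ {n} (w : Vec Bool n) → schreierᵇ (w ∷ʳ false) ≡ schreierᵇ w
schreierᵇ-∷ʳ-false w rewrite isEmptyᵇ-∷ʳ w false | size-∷ʳ-false w with isEmptyᵇ w in empty?
... | true  = refl
... | false rewrite minFrom-∷ʳ 1 w false empty? = refl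

schreierᵇ-false∷-∷ʳ-true : ∀ {n} (u : Vec Bool n) → schreierᵇ (false ∷ (u ∷ʳ true)) ≡ schreierᵇ u
schreierᵇ-false∷-∷ʳ-true u rewrite isEmptyᵇ-∷ʳ u true | size-∷ʳ-true u with isEmptyᵇ u in empty?
... | true  rewrite minFrom-∅-∷ʳ-true 2 u empty? | isEmptyᵇ⇒size≡0 u empty? = refl
... | false rewrite minFrom-∷ʳ 2 u true empty? | minFrom-suc 1 u empty? = refl

count-schreierᵇ : ∀ m → count m schreierᵇ ≡ F (suc m)
count-schreierᵇ zero          = refl
count-schreierᵇ (suc zero)    = refl
count-schreierᵇ (suc (suc m)) = begin
  count (suc (suc m)) schreierᵇ
    ≡⟨ count-∷ʳ (suc m) schreierᵇ ⟩
  (count m (λ u → schreierᵇ (true ∷ (u ∷ʳ true))) + count m (λ u → schreierᵇ (false ∷ (u ∷ʳ true))))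
    + count (suc m) (λ w → schreierᵇ (w ∷ʳ false))
    -- 1 and m+2 both in W already give |W| ≥ 2 > min W, so the first count vanishes.
    ≡⟨ cong₂ _+_ (cong₂ _+_ (count-false m) (count-cong m schreierᵇ-false∷-∷ʳ-true))
                 (count-cong (suc m) schreierᵇ-∷ʳ-false) ⟩
  count m schreierᵇ + count (suc m) schreierᵇ
    ≡⟨ cong₂ _+_ (count-schreierᵇ m) (count-schreierᵇ (suc m)) ⟩
  F (suc m) + F (suc (suc m))
    ≡⟨ +-comm (F (suc m)) (F (suc (suc m))) ⟩
  F (suc (suc (suc m))) ∎

in𝒜-diagonal-∷ʳ : ∀ m (w : Vec Bool m) b → does (in𝒜? (suc m) (w ∷ʳ b)) ≡ schreierᵇ w
in𝒜-diagonal-∷ʳ m w b rewrite does-≟-∅ (w ∷ʳ b) | isEmptyᵇ-∷ʳ w b | ωFrom-last 1 w b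
  with isEmptyᵇ w in empty? | b
... | true  | true  rewrite minFrom-∅-∷ʳ-true 1 w empty? | isEmptyᵇ⇒size≡0 w empty? = refl
... | true  | false = refl
... | false | b     rewrite minFrom-∷ʳ 1 w b empty? = refl

theorem1p1 : (n : ℕ) → 1 ≤ n → a n n ≡ 2 * F n
theorem1p1 (suc m) _ = begin
  a (suc m) (suc m)
    ≡⟨ length-filter-allSubsets (suc m) (in𝒜? (suc m)) ⟩
  count (suc m) (λ v → does (in𝒜? (suc m) v))
    ≡⟨ count-∷ʳ m (λ v → does (in𝒜? (suc m) v)) ⟩
  count m (λ w → does (in𝒜? (suc m) (w ∷ʳ true))) + count m (λ w → does (in𝒜? (suc m) (w ∷ʳ false)))
    ≡⟨ cong₂ _+_ (count-cong m (λ w → in𝒜-diagonal-∷ʳ m w true))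
                 (count-cong m (λ w → in𝒜-diagonal-∷ʳ m w false)) ⟩
  count m schreierᵇ + count m schreierᵇ
    ≡⟨ cong₂ _+_ (count-schreierᵇ m) (count-schreierᵇ m) ⟩
  F (suc m) + F (suc m)
    ≡⟨ cong (F (suc m) +_) (sym (+-identityʳ (F (suc m)))) ⟩
  2 * F (suc m) ∎
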